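{- Let $q$ be a power of an odd prime $p$, and let $e$ be an integer with $0\le e<q$. In the polynomial ring $\mathbb{Z}[\beta]$, set $x=\beta(1-\beta)$ and $\alpha=1-\beta$. Then \[ \sum_{0\le k<(q-e)/2}\binom{2k+e}{k}x^k\equiv\frac{\alpha^{q-e}-\beta^{q-e}}{\alpha-\beta}\pmod{p}, \] and \[ \sum_{0\le k<q}\binom{2k+e}{k}x^k\equiv\frac{\alpha^{2q-e}-\beta^{2q-e}}{\alpha-\beta}\pmod{p}. \] (The right-hand sides are polynomials in $\beta$ with integer coefficients, since $\alpha-\beta$ divides $\alpha^n-\beta^n$.) -}

module Defs where

open import Data.Nat as ℕ using (ℕ; zero; suc; _<_; _<?_; _∸_)
open import Data.Nat.Combinatorics using (_C_)
open import Data.Integer as ℤ using (ℤ; +_; 0ℤ; 1ℤ)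
open import Data.Integer.Divisibility using (_∣_)
open import Data.List using (List; []; _∷_)
open import Relation.Binary.PropositionalEquality using (_≡_)
open import Relation.Nullary.Decidable using (⌊_⌋)
open import Data.Bool using (if_then_else_)

-- Polynomials in ℤ[β], as coefficient lists (lowest degree first).
Poly : Set
Poly = List ℤ

coeff : Poly → ℕ → ℤ
coeff []       _       = 0ℤ
coeff (a ∷ _)  zero    = a
coeff (_ ∷ as) (suc i) = coeff as i

infixl 6 _+ₚ_ _-ₚ_
infixl 7 _*ₚ_ _·ₚ_
infixr 8 _^ₚ_
infix 4 _≈ₚ_ _≡ₚ_[mod_]

_+ₚ_ : Poly → Poly → Poly
[]       +ₚ q        = q
(a ∷ p)  +ₚ []       = a ∷ p
(a ∷ p)  +ₚ (b ∷ q)  = (a ℤ.+ b) ∷ (p +ₚ q)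

_·ₚ_ : ℤ → Poly → Poly
c ·ₚ []      = []
c ·ₚ (a ∷ p) = (c ℤ.* a) ∷ (c ·ₚ p)

-ₚ_ : Poly → Poly
-ₚ p = ℤ.- 1ℤ ·ₚ p

_-ₚ_ : Poly → Poly → Poly
p -ₚ q = p +ₚ (-ₚ q)

_*ₚ_ : Poly → Poly → Poly
[]      *ₚ q = []
(a ∷ p) *ₚ q = (a ·ₚ q) +ₚ (0ℤ ∷ (p *ₚ q))

oneₚ : Poly
oneₚ = 1ℤ ∷ []

_^ₚ_ : Poly → ℕ → Poly
p ^ₚ zero  = oneₚ
p ^ₚ suc n = p *ₚ (p ^ₚ n)

-- Equality of polynomials in ℤ[β] (coefficientwise, so trailing zeros are irrelevant).
_≈ₚ_ : Poly → Poly → Set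
P ≈ₚ Q = ∀ i → coeff P i ≡ coeff Q i

_≡ₚ_[mod_] : Poly → Poly → ℕ → Set
P ≡ₚ Q [mod m ] = ∀ i → (+ m) ∣ (coeff P i ℤ.- coeff Q i)

Σₚ : ℕ → (ℕ → Poly) → Poly
Σₚ zero    f = []
Σₚ (suc n) f = Σₚ n f +ₚ f n

βₚ : Poly
βₚ = 0ℤ ∷ 1ℤ ∷ []

αₚ : Poly
αₚ = oneₚ -ₚ βₚ

xₚ : Poly
xₚ = βₚ *ₚ (oneₚ -ₚ βₚ)

term : ℕ → ℕ → Poly
term e k = (+ ((2 ℕ.* k ℕ.+ e) C k)) ·ₚ (xₚ ^ₚ k)

-- Σ_{0 ≤ k < (q-e)/2} binom(2k+e,k) x^k ; the condition k < (q-e)/2 is 2k < q - e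
-- (every such k is < q, so summing over k < q with this filter is exact).
lhs₁ : ℕ → ℕ → Poly
lhs₁ q e = Σₚ q (λ k → if ⌊ 2 ℕ.* k <? q ∸ e ⌋ then term e k else [])

lhs₂ : ℕ → ℕ → Poly
lhs₂ q e = Σₚ q (term e)

module Submission where

-- Let Fₙ(y) be the polynomials F₀ = 0, F₁ = 1, Fₙ₊₂ = Fₙ₊₁ - y Fₙ. Since α + β = 1 and
-- αβ = x, Binet's formula (α - β) Fₙ(x) = αⁿ - βⁿ holds, and α - β = 1 - 2β is not a
-- zero divisor, so each quotient in the theorem is F_{N-e}(x) with N = q or N = 2q.
-- The coefficients of Fₙ₊₁ are [yᵏ] Fₙ₊₁ = (-1)ᵏ C(n - k, k). When q ∣ N, p divides
-- C(N, j) for 0 < j < q, and Pascal's rule propagates this to the congruence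
-- (-1)ʲ C(N - s, j) ≡ C(s + j - 1, j) (mod p) for j < q; taking s = e + k + 1 gives
-- [yᵏ] F_{N-e} ≡ C(2k + e, k), so both sums agree with F_{N-e}(x) term by term.

open import Defs
open import Level using (0ℓ)
open import Data.Nat as ℕ using (ℕ; zero; suc; _∸_; _<_; _≤_; _^_; _*_; _%_; _<?_)
import Data.Nat.Properties as ℕP
open import Data.Nat.Combinatorics using (_C_; nCk+nC[k+1]≡[n+1]C[k+1]; k>n⇒nCk≡0; nC1≡n)
import Data.Nat.Divisibility as ℕ∣
open ℕ∣ using (divides-refl) renaming (_∣_ to _∣ℕ_)
open import Data.Nat.Primality using (Prime; euclidsLemma; prime⇒nonZero)
import Data.Nat.Solver
open import Data.Integer as ℤ using (ℤ; +_; 0ℤ; 1ℤ)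
import Data.Integer.Properties as ℤP
import Data.Integer.Solver
open import Data.Integer.Divisibility.Signed
  using (_∣_; divides; ∣m⇒∣-m; ∣m∣n⇒∣m+n; ∣m⇒∣m*n; ∣n⇒∣m*n; ∣⇒∣ᵤ; ∣ᵤ⇒∣)
open import Data.List using ([]; _∷_)
open import Data.Maybe using (Maybe; just; nothing)
open import Data.Product using (_×_; _,_)
open import Data.Bool using (if_then_else_)
open import Relation.Nullary.Decidable using (⌊_⌋)
open import Relation.Nullary using (yes; no; ¬_)
open import Data.Empty using (⊥-elim)
open import Data.Sum using (inj₁; inj₂)
open import Function using (_$_)
open import Relation.Binary.PropositionalEquality
open import Algebra.Bundles using (CommutativeRing)
open import Algebra.Solver.Ring.AlmostCommutativeRing using (_-Raw-AlmostCommutative⟶_; fromCommutativeRing)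
import Algebra.Solver.Ring
import Relation.Binary.Reasoning.Setoid

module ZS = Data.Integer.Solver.+-*-Solver
module NS = Data.Nat.Solver.+-*-Solver

-- The polynomial ring ℤ[β] as a commutative ring.

infix 4 _≈_

-- Coefficientwise equality (the relation _≈ₚ_ of Defs), wrapped in a record
-- so that Agda can recover the two polynomials from a proof of it.
record _≈_ (P Q : Poly) : Set where
  constructor coeffwise
  field coeff-≡ : ∀ i → coeff P i ≡ coeff Q i
open _≈_ public

coeff-+ : ∀ P Q i → coeff (P +ₚ Q) i ≡ coeff P i ℤ.+ coeff Q i
coeff-+ []      Q       i       = sym (ℤP.+-identityˡ _)
coeff-+ (a ∷ P) []      i       = sym (ℤP.+-identityʳ _)
coeff-+ (a ∷ P) (b ∷ Q) zero    = refl
coeff-+ (a ∷ P) (b ∷ Q) (suc i) = coeff-+ P Q i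

coeff-· : ∀ a P i → coeff (a ·ₚ P) i ≡ a ℤ.* coeff P i
coeff-· a []      i       = sym (ℤP.*-zeroʳ a)
coeff-· a (b ∷ P) zero    = refl
coeff-· a (b ∷ P) (suc i) = coeff-· a P i

≈-refl : ∀ {P} → P ≈ P
≈-refl = coeffwise (λ _ → refl)

≈-sym : ∀ {P Q} → P ≈ Q → Q ≈ P
≈-sym P≈Q = coeffwise (λ i → sym (coeff-≡ P≈Q i))

≈-trans : ∀ {P Q R} → P ≈ Q → Q ≈ R → P ≈ R
≈-trans P≈Q Q≈R = coeffwise (λ i → trans (coeff-≡ P≈Q i) (coeff-≡ Q≈R i))

∷-cong : ∀ {a b P Q} → a ≡ b → P ≈ Q → (a ∷ P) ≈ (b ∷ Q)
∷-cong a≡b P≈Q = coeffwise λ { zero → a≡b ; (suc i) → coeff-≡ P≈Q i }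

0∷[]≈[] : (0ℤ ∷ []) ≈ []
0∷[]≈[] = coeffwise λ { zero → refl ; (suc i) → refl }

+ₚ-cong : ∀ {P P′ Q Q′} → P ≈ P′ → Q ≈ Q′ → P +ₚ Q ≈ P′ +ₚ Q′
+ₚ-cong {P} {P′} {Q} {Q′} P≈P′ Q≈Q′ = coeffwise λ i → begin
  coeff (P +ₚ Q) i            ≡⟨ coeff-+ P Q i ⟩
  coeff P i ℤ.+ coeff Q i     ≡⟨ cong₂ ℤ._+_ (coeff-≡ P≈P′ i) (coeff-≡ Q≈Q′ i) ⟩
  coeff P′ i ℤ.+ coeff Q′ i   ≡⟨ coeff-+ P′ Q′ i ⟨
  coeff (P′ +ₚ Q′) i          ∎
  where open ≡-Reasoning

+ₚ-congˡ : ∀ P {Q Q′} → Q ≈ Q′ → P +ₚ Q ≈ P +ₚ Q′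
+ₚ-congˡ P = +ₚ-cong (≈-refl {P})

+ₚ-congʳ : ∀ Q {P P′} → P ≈ P′ → P +ₚ Q ≈ P′ +ₚ Q
+ₚ-congʳ Q P≈P′ = +ₚ-cong P≈P′ (≈-refl {Q})

·ₚ-cong : ∀ a {P P′} → P ≈ P′ → a ·ₚ P ≈ a ·ₚ P′
·ₚ-cong a {P} {P′} P≈P′ = coeffwise λ i → begin
  coeff (a ·ₚ P) i      ≡⟨ coeff-· a P i ⟩
  a ℤ.* coeff P i       ≡⟨ cong (a ℤ.*_) (coeff-≡ P≈P′ i) ⟩
  a ℤ.* coeff P′ i      ≡⟨ coeff-· a P′ i ⟨
  coeff (a ·ₚ P′) i     ∎
  where open ≡-Reasoning

-ₚ-cong : ∀ {P Q} → P ≈ Q → -ₚ P ≈ -ₚ Q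
-ₚ-cong = ·ₚ-cong (ℤ.- 1ℤ)

+ₚ-assoc : ∀ P Q R → (P +ₚ Q) +ₚ R ≈ P +ₚ (Q +ₚ R)
+ₚ-assoc P Q R = coeffwise λ i →
  begin
    coeff ((P +ₚ Q) +ₚ R) i                       ≡⟨ coeff-+ (P +ₚ Q) R i ⟩
    coeff (P +ₚ Q) i ℤ.+ coeff R i                ≡⟨ cong (ℤ._+ coeff R i) (coeff-+ P Q i) ⟩
    (coeff P i ℤ.+ coeff Q i) ℤ.+ coeff R i       ≡⟨ ℤP.+-assoc (coeff P i) (coeff Q i) (coeff R i) ⟩
    coeff P i ℤ.+ (coeff Q i ℤ.+ coeff R i)       ≡⟨ cong (ℤ._+_ (coeff P i)) (coeff-+ Q R i) ⟨
    coeff P i ℤ.+ coeff (Q +ₚ R) i                ≡⟨ coeff-+ P (Q +ₚ R) i ⟨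
    coeff (P +ₚ (Q +ₚ R)) i                       ∎
  where open ≡-Reasoning

+ₚ-comm : ∀ P Q → P +ₚ Q ≈ Q +ₚ P
+ₚ-comm P Q = coeffwise λ i → begin
  coeff (P +ₚ Q) i          ≡⟨ coeff-+ P Q i ⟩
  coeff P i ℤ.+ coeff Q i   ≡⟨ ℤP.+-comm (coeff P i) (coeff Q i) ⟩
  coeff Q i ℤ.+ coeff P i   ≡⟨ coeff-+ Q P i ⟨
  coeff (Q +ₚ P) i          ∎
  where open ≡-Reasoning

+ₚ-identityʳ : ∀ P → P +ₚ [] ≈ P
+ₚ-identityʳ P = coeffwise λ i → trans (coeff-+ P [] i) (ℤP.+-identityʳ (coeff P i))

+ₚ-inverseʳ : ∀ P → P +ₚ (-ₚ P) ≈ []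
+ₚ-inverseʳ P = coeffwise λ i → begin
  coeff (P +ₚ (-ₚ P)) i                           ≡⟨ coeff-+ P (-ₚ P) i ⟩
  coeff P i ℤ.+ coeff (-ₚ P) i                    ≡⟨ cong (ℤ._+_ (coeff P i)) (coeff-· (ℤ.- 1ℤ) P i) ⟩
  coeff P i ℤ.+ (ℤ.- 1ℤ) ℤ.* coeff P i            ≡⟨ cong (ℤ._+_ (coeff P i)) (ℤP.-1*i≡-i (coeff P i)) ⟩
  coeff P i ℤ.- coeff P i                         ≡⟨ ℤP.+-inverseʳ (coeff P i) ⟩
  0ℤ                                              ∎
  where open ≡-Reasoning

+ₚ-inverseˡ : ∀ P → (-ₚ P) +ₚ P ≈ []
+ₚ-inverseˡ P = ≈-trans (+ₚ-comm (-ₚ P) P) (+ₚ-inverseʳ P)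

+ₚ-middle-four : ∀ P Q R S → (P +ₚ Q) +ₚ (R +ₚ S) ≈ (P +ₚ R) +ₚ (Q +ₚ S)
+ₚ-middle-four P Q R S = coeffwise at
  where
  open ≡-Reasoning
  open ZS
  at : ∀ i → coeff ((P +ₚ Q) +ₚ (R +ₚ S)) i ≡ coeff ((P +ₚ R) +ₚ (Q +ₚ S)) i
  at i = begin
    coeff ((P +ₚ Q) +ₚ (R +ₚ S)) i
      ≡⟨ coeff-+ (P +ₚ Q) (R +ₚ S) i ⟩
    coeff (P +ₚ Q) i ℤ.+ coeff (R +ₚ S) i
      ≡⟨ cong₂ ℤ._+_ (coeff-+ P Q i) (coeff-+ R S i) ⟩
    (a ℤ.+ b) ℤ.+ (c ℤ.+ d)
      ≡⟨ solve 4 (λ a b c d → (a :+ b) :+ (c :+ d) := (a :+ c) :+ (b :+ d)) refl a b c d ⟩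
    (a ℤ.+ c) ℤ.+ (b ℤ.+ d)
      ≡⟨ cong₂ ℤ._+_ (coeff-+ P R i) (coeff-+ Q S i) ⟨
    coeff (P +ₚ R) i ℤ.+ coeff (Q +ₚ S) i
      ≡⟨ coeff-+ (P +ₚ R) (Q +ₚ S) i ⟨
    coeff ((P +ₚ R) +ₚ (Q +ₚ S)) i ∎
    where a = coeff P i; b = coeff Q i; c = coeff R i; d = coeff S i

+ₚ-left-comm : ∀ P Q R → P +ₚ (Q +ₚ R) ≈ Q +ₚ (P +ₚ R)
+ₚ-left-comm P Q R =
  ≈-trans (≈-sym (+ₚ-assoc P Q R)) (≈-trans (+ₚ-congʳ R (+ₚ-comm P Q)) (+ₚ-assoc Q P R))

·ₚ-distrib-+ₚ : ∀ a P Q → a ·ₚ (P +ₚ Q) ≈ a ·ₚ P +ₚ a ·ₚ Q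
·ₚ-distrib-+ₚ a P Q = coeffwise λ i → begin
  coeff (a ·ₚ (P +ₚ Q)) i                   ≡⟨ coeff-· a (P +ₚ Q) i ⟩
  a ℤ.* coeff (P +ₚ Q) i                    ≡⟨ cong (a ℤ.*_) (coeff-+ P Q i) ⟩
  a ℤ.* (coeff P i ℤ.+ coeff Q i)           ≡⟨ ℤP.*-distribˡ-+ a (coeff P i) (coeff Q i) ⟩
  a ℤ.* coeff P i ℤ.+ a ℤ.* coeff Q i       ≡⟨ cong₂ ℤ._+_ (coeff-· a P i) (coeff-· a Q i) ⟨
  coeff (a ·ₚ P) i ℤ.+ coeff (a ·ₚ Q) i     ≡⟨ coeff-+ (a ·ₚ P) (a ·ₚ Q) i ⟨
  coeff (a ·ₚ P +ₚ a ·ₚ Q) i                ∎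
  where open ≡-Reasoning

+-distrib-·ₚ : ∀ a b P → (a ℤ.+ b) ·ₚ P ≈ a ·ₚ P +ₚ b ·ₚ P
+-distrib-·ₚ a b P = coeffwise λ i → begin
  coeff ((a ℤ.+ b) ·ₚ P) i                  ≡⟨ coeff-· (a ℤ.+ b) P i ⟩
  (a ℤ.+ b) ℤ.* coeff P i                   ≡⟨ ℤP.*-distribʳ-+ (coeff P i) a b ⟩
  a ℤ.* coeff P i ℤ.+ b ℤ.* coeff P i       ≡⟨ cong₂ ℤ._+_ (coeff-· a P i) (coeff-· b P i) ⟨
  coeff (a ·ₚ P) i ℤ.+ coeff (b ·ₚ P) i     ≡⟨ coeff-+ (a ·ₚ P) (b ·ₚ P) i ⟨
  coeff (a ·ₚ P +ₚ b ·ₚ P) i                ∎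
  where open ≡-Reasoning

·ₚ-assoc : ∀ a b P → (a ℤ.* b) ·ₚ P ≈ a ·ₚ (b ·ₚ P)
·ₚ-assoc a b P = coeffwise λ i → begin
  coeff ((a ℤ.* b) ·ₚ P) i        ≡⟨ coeff-· (a ℤ.* b) P i ⟩
  (a ℤ.* b) ℤ.* coeff P i         ≡⟨ ℤP.*-assoc a b (coeff P i) ⟩
  a ℤ.* (b ℤ.* coeff P i)         ≡⟨ cong (a ℤ.*_) (coeff-· b P i) ⟨
  a ℤ.* coeff (b ·ₚ P) i          ≡⟨ coeff-· a (b ·ₚ P) i ⟨
  coeff (a ·ₚ (b ·ₚ P)) i         ∎
  where open ≡-Reasoning

0·ₚ : ∀ P → 0ℤ ·ₚ P ≈ []
0·ₚ P = coeffwise (coeff-· 0ℤ P)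

1·ₚ : ∀ P → 1ℤ ·ₚ P ≈ P
1·ₚ P = coeffwise λ i → trans (coeff-· 1ℤ P i) (ℤP.*-identityˡ (coeff P i))

zero·ₚ : ∀ {a} P → a ≡ 0ℤ → a ·ₚ P ≈ []
zero·ₚ P refl = 0·ₚ P

-- Shifting (multiplication by β, written 0 ∷ _) is additive.
shift-+ₚ : ∀ P Q → (0ℤ ∷ (P +ₚ Q)) ≈ (0ℤ ∷ P) +ₚ (0ℤ ∷ Q)
shift-+ₚ P Q = ∷-cong refl ≈-refl

*ₚ-zeroˡ : ∀ Z R → Z ≈ [] → Z *ₚ R ≈ []
*ₚ-zeroˡ []      R Z≈0 = ≈-refl
*ₚ-zeroˡ (a ∷ Z) R Z≈0 =
  ≈-trans (+ₚ-cong (zero·ₚ R (coeff-≡ Z≈0 zero))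
                   (∷-cong refl (*ₚ-zeroˡ Z R (coeffwise λ i → coeff-≡ Z≈0 (suc i)))))
          0∷[]≈[]

*ₚ-zeroʳ : ∀ P → P *ₚ [] ≈ []
*ₚ-zeroʳ []      = ≈-refl
*ₚ-zeroʳ (a ∷ P) = ≈-trans (∷-cong refl (*ₚ-zeroʳ P)) 0∷[]≈[]

-- Multiplication respects ≈; representatives of different lengths are compared
-- through the vanishing case above.
*ₚ-congʳ : ∀ R {P P′} → P ≈ P′ → P *ₚ R ≈ P′ *ₚ R
*ₚ-congʳ R {[]}    {[]}     P≈P′ = ≈-refl
*ₚ-congʳ R {[]}    {b ∷ P′} P≈P′ = ≈-sym (*ₚ-zeroˡ (b ∷ P′) R (≈-sym P≈P′))
*ₚ-congʳ R {a ∷ P} {[]}     P≈P′ = *ₚ-zeroˡ (a ∷ P) R P≈P′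
*ₚ-congʳ R {a ∷ P} {b ∷ P′} P≈P′ with coeff-≡ P≈P′ zero
... | refl = +ₚ-congˡ (a ·ₚ R) (∷-cong refl (*ₚ-congʳ R {P} {P′} (coeffwise λ i → coeff-≡ P≈P′ (suc i))))

*ₚ-congˡ : ∀ P {R R′} → R ≈ R′ → P *ₚ R ≈ P *ₚ R′
*ₚ-congˡ []      R≈R′ = ≈-refl
*ₚ-congˡ (a ∷ P) R≈R′ = +ₚ-cong (·ₚ-cong a R≈R′) (∷-cong refl (*ₚ-congˡ P R≈R′))

*ₚ-∷ : ∀ P b Q → P *ₚ (b ∷ Q) ≈ b ·ₚ P +ₚ (0ℤ ∷ (P *ₚ Q))
*ₚ-∷ []      b Q = ≈-sym 0∷[]≈[]
*ₚ-∷ (c ∷ P) b Q =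
  ∷-cong (cong (ℤ._+ 0ℤ) (ℤP.*-comm c b))
         (≈-trans (+ₚ-congˡ (c ·ₚ Q) (*ₚ-∷ P b Q)) (+ₚ-left-comm (c ·ₚ Q) (b ·ₚ P) (0ℤ ∷ (P *ₚ Q))))

*ₚ-comm : ∀ P Q → P *ₚ Q ≈ Q *ₚ P
*ₚ-comm []      Q = ≈-sym (*ₚ-zeroʳ Q)
*ₚ-comm (a ∷ P) Q = ≈-trans (+ₚ-congˡ (a ·ₚ Q) (∷-cong refl (*ₚ-comm P Q))) (≈-sym (*ₚ-∷ Q a P))

*ₚ-distribʳ : ∀ R X Y → (X +ₚ Y) *ₚ R ≈ X *ₚ R +ₚ Y *ₚ R
*ₚ-distribʳ R []      Y       = ≈-refl
*ₚ-distribʳ R (a ∷ X) []      = ≈-sym (+ₚ-identityʳ _)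
*ₚ-distribʳ R (a ∷ X) (b ∷ Y) =
  ≈-trans (+ₚ-cong (+-distrib-·ₚ a b R)
                   (≈-trans (∷-cong refl (*ₚ-distribʳ R X Y)) (shift-+ₚ (X *ₚ R) (Y *ₚ R))))
          (+ₚ-middle-four (a ·ₚ R) (b ·ₚ R) (0ℤ ∷ (X *ₚ R)) (0ℤ ∷ (Y *ₚ R)))

*ₚ-distribˡ : ∀ R X Y → R *ₚ (X +ₚ Y) ≈ R *ₚ X +ₚ R *ₚ Y
*ₚ-distribˡ R X Y =
  ≈-trans (*ₚ-comm R (X +ₚ Y)) (≈-trans (*ₚ-distribʳ R X Y) (+ₚ-cong (*ₚ-comm X R) (*ₚ-comm Y R)))

·ₚ-*ₚ : ∀ a Q R → (a ·ₚ Q) *ₚ R ≈ a ·ₚ (Q *ₚ R)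
·ₚ-*ₚ a []      R = ≈-refl
·ₚ-*ₚ a (b ∷ Q) R =
  ≈-trans (+ₚ-cong (·ₚ-assoc a b R) (∷-cong (sym (ℤP.*-zeroʳ a)) (·ₚ-*ₚ a Q R)))
          (≈-sym (·ₚ-distrib-+ₚ a (b ·ₚ R) (0ℤ ∷ (Q *ₚ R))))

*ₚ-assoc : ∀ P Q R → (P *ₚ Q) *ₚ R ≈ P *ₚ (Q *ₚ R)
*ₚ-assoc []      Q R = ≈-refl
*ₚ-assoc (a ∷ P) Q R =
  ≈-trans (*ₚ-distribʳ R (a ·ₚ Q) (0ℤ ∷ (P *ₚ Q)))
          (+ₚ-cong (·ₚ-*ₚ a Q R) (≈-trans (+ₚ-congʳ (0ℤ ∷ ((P *ₚ Q) *ₚ R)) (0·ₚ R)) (∷-cong refl (*ₚ-assoc P Q R))))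

*ₚ-identityˡ : ∀ P → oneₚ *ₚ P ≈ P
*ₚ-identityˡ P = ≈-trans (+ₚ-cong (1·ₚ P) 0∷[]≈[]) (+ₚ-identityʳ P)

*ₚ-identityʳ : ∀ P → P *ₚ oneₚ ≈ P
*ₚ-identityʳ P = ≈-trans (*ₚ-comm P oneₚ) (*ₚ-identityˡ P)

ℤ[β] : CommutativeRing 0ℓ 0ℓ
ℤ[β] = record
  { Carrier = Poly ; _≈_ = _≈_ ; _+_ = _+ₚ_ ; _*_ = _*ₚ_ ; -_ = -ₚ_ ; 0# = [] ; 1# = oneₚ
  ; isCommutativeRing = record
    { isRing = record
      { +-isAbelianGroup = record
        { isGroup = record
          { isMonoid = record
            { isSemigroup = record
              { isMagma = record
                { isEquivalence = record { refl = ≈-refl ; sym = ≈-sym ; trans = ≈-trans }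
                ; ∙-cong = +ₚ-cong }
              ; assoc = +ₚ-assoc }
            ; identity = (λ _ → ≈-refl) , +ₚ-identityʳ }
          ; inverse = +ₚ-inverseˡ , +ₚ-inverseʳ
          ; ⁻¹-cong = -ₚ-cong }
        ; comm = +ₚ-comm }
      ; *-cong = λ {P} {P′} {Q} {Q′} P≈P′ Q≈Q′ → ≈-trans (*ₚ-congʳ Q P≈P′) (*ₚ-congˡ P′ Q≈Q′)
      ; *-assoc = *ₚ-assoc
      ; *-identity = *ₚ-identityˡ , *ₚ-identityʳ
      ; distrib = *ₚ-distribˡ , *ₚ-distribʳ }
    ; *-comm = *ₚ-comm } }

const : ℤ → Poly
const c = c ∷ []

const-homomorphism : ℤ.+-*-rawRing -Raw-AlmostCommutative⟶ fromCommutativeRing ℤ[β]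
const-homomorphism = record
  { ⟦_⟧    = const
  ; +-homo = λ _ _ → ≈-refl
  ; *-homo = λ _ _ → ∷-cong (sym (ℤP.+-identityʳ _)) ≈-refl
  ; -‿homo = λ a → ∷-cong (sym (ℤP.-1*i≡-i a)) ≈-refl
  ; 0-homo = 0∷[]≈[]
  ; 1-homo = ≈-refl }

const-≟ : ∀ a b → Maybe (const a ≈ const b)
const-≟ a b with a ℤ.≟ b
... | yes refl = just ≈-refl
... | no _     = nothing

module PolySolver = Algebra.Solver.Ring ℤ.+-*-rawRing (fromCommutativeRing ℤ[β]) const-homomorphism const-≟

module ≈-Reasoning where
  open Relation.Binary.Reasoning.Setoid (CommutativeRing.setoid ℤ[β]) public
  open PolySolver using (solve; _:+_; _:*_; _:-_; _:=_; con) public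

Σₚ-cong : ∀ N {f g} → (∀ k → f k ≈ g k) → Σₚ N f ≈ Σₚ N g
Σₚ-cong zero    f≈g = ≈-refl
Σₚ-cong (suc N) f≈g = +ₚ-cong (Σₚ-cong N f≈g) (f≈g N)

Σₚ-suc : ∀ N f → Σₚ (suc N) f ≈ f 0 +ₚ Σₚ N (λ k → f (suc k))
Σₚ-suc zero    f = ≈-sym (+ₚ-identityʳ (f 0))
Σₚ-suc (suc N) f =
  ≈-trans (+ₚ-congʳ (f (suc N)) (Σₚ-suc N f)) (+ₚ-assoc (f 0) (Σₚ N (λ k → f (suc k))) (f (suc N)))

*ₚ-Σₚ : ∀ N X f → X *ₚ Σₚ N f ≈ Σₚ N (λ k → X *ₚ f k)
*ₚ-Σₚ zero    X f = *ₚ-zeroʳ X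
*ₚ-Σₚ (suc N) X f = ≈-trans (*ₚ-distribˡ X (Σₚ N f) (f N)) (+ₚ-congʳ (X *ₚ f N) (*ₚ-Σₚ N X f))

-- Substitution y ↦ x = β(1 - β) in a polynomial in an auxiliary variable y,
-- which is again represented by its list of coefficients.
at-x : Poly → Poly
at-x []      = []
at-x (a ∷ c) = const a +ₚ xₚ *ₚ at-x c

at-x-+ : ∀ c d → at-x (c +ₚ d) ≈ at-x c +ₚ at-x d
at-x-+ []      d       = ≈-refl
at-x-+ (a ∷ c) []      = ≈-sym (+ₚ-identityʳ _)
at-x-+ (a ∷ c) (b ∷ d) = begin
  const a +ₚ const b +ₚ xₚ *ₚ at-x (c +ₚ d)     ≈⟨ +ₚ-congˡ (const a +ₚ const b) (*ₚ-congˡ xₚ (at-x-+ c d)) ⟩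
  const a +ₚ const b +ₚ xₚ *ₚ (at-x c +ₚ at-x d)
    ≈⟨ solve 5 (λ a b x u v → (a :+ b) :+ x :* (u :+ v) := (a :+ x :* u) :+ (b :+ x :* v))
               ≈-refl (const a) (const b) xₚ (at-x c) (at-x d) ⟩
  at-x (a ∷ c) +ₚ at-x (b ∷ d)                  ∎
  where open ≈-Reasoning

at-x-· : ∀ a c → at-x (a ·ₚ c) ≈ const a *ₚ at-x c
at-x-· a []      = ≈-sym (*ₚ-zeroʳ (const a))
at-x-· a (b ∷ c) = begin
  const (a ℤ.* b) +ₚ xₚ *ₚ at-x (a ·ₚ c)
    ≈⟨ +ₚ-cong (∷-cong (sym (ℤP.+-identityʳ _)) ≈-refl) (*ₚ-congˡ xₚ (at-x-· a c)) ⟩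
  const a *ₚ const b +ₚ xₚ *ₚ (const a *ₚ at-x c)
    ≈⟨ solve 4 (λ a b x u → a :* b :+ x :* (a :* u) := a :* (b :+ x :* u))
               ≈-refl (const a) (const b) xₚ (at-x c) ⟩
  const a *ₚ at-x (b ∷ c)                          ∎
  where open ≈-Reasoning

at-x-shift : ∀ c → at-x (0ℤ ∷ c) ≈ xₚ *ₚ at-x c
at-x-shift c = +ₚ-cong 0∷[]≈[] ≈-refl

at-x-as-sum : ∀ c N → (∀ k → N ℕ.≤ k → coeff c k ≡ 0ℤ) →
              at-x c ≈ Σₚ N (λ k → coeff c k ·ₚ (xₚ ^ₚ k))
at-x-as-sum []      zero    _        = ≈-refl
at-x-as-sum []      (suc N) _        =
  ≈-sym (+ₚ-cong (≈-sym (at-x-as-sum [] N (λ _ _ → refl))) (0·ₚ (xₚ ^ₚ N)))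
at-x-as-sum (a ∷ c) zero    c-vanishes =
  +ₚ-cong (≈-trans (∷-cong (c-vanishes 0 ℕ.z≤n) ≈-refl) 0∷[]≈[])
          (≈-trans (*ₚ-congˡ xₚ (at-x-as-sum c zero (λ k _ → c-vanishes (suc k) ℕ.z≤n))) (*ₚ-zeroʳ xₚ))
at-x-as-sum (a ∷ c) (suc N) c-vanishes = ≈-sym (begin
  Σₚ (suc N) (λ k → coeff (a ∷ c) k ·ₚ (xₚ ^ₚ k))
    ≈⟨ Σₚ-suc N (λ k → coeff (a ∷ c) k ·ₚ (xₚ ^ₚ k)) ⟩
  a ·ₚ oneₚ +ₚ Σₚ N (λ k → coeff c k ·ₚ (xₚ *ₚ xₚ ^ₚ k))
    ≈⟨ +ₚ-cong (∷-cong (ℤP.*-identityʳ a) ≈-refl) (Σₚ-cong N λ k → ·ₚ-inside (coeff c k) xₚ (xₚ ^ₚ k)) ⟩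
  const a +ₚ Σₚ N (λ k → xₚ *ₚ (coeff c k ·ₚ (xₚ ^ₚ k)))
    ≈⟨ +ₚ-congˡ (const a) (≈-sym (*ₚ-Σₚ N xₚ _)) ⟩
  const a +ₚ xₚ *ₚ Σₚ N (λ k → coeff c k ·ₚ (xₚ ^ₚ k))
    ≈⟨ +ₚ-congˡ (const a) (*ₚ-congˡ xₚ (≈-sym (at-x-as-sum c N λ k N≤k → c-vanishes (suc k) (ℕ.s≤s N≤k)))) ⟩
  at-x (a ∷ c) ∎)
  where
  open ≈-Reasoning
  ·ₚ-inside : ∀ a X Y → a ·ₚ (X *ₚ Y) ≈ X *ₚ (a ·ₚ Y)
  ·ₚ-inside a X Y = begin
    a ·ₚ (X *ₚ Y)   ≈⟨ ·ₚ-cong a (*ₚ-comm X Y) ⟩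
    a ·ₚ (Y *ₚ X)   ≈⟨ ·ₚ-*ₚ a Y X ⟨
    (a ·ₚ Y) *ₚ X   ≈⟨ *ₚ-comm (a ·ₚ Y) X ⟩
    X *ₚ (a ·ₚ Y)   ∎

F : ℕ → Poly
F 0             = []
F 1             = oneₚ
F (suc (suc n)) = F (suc n) -ₚ (0ℤ ∷ F n)

V : ℕ → Poly
V n = at-x (F n)

V-rec : ∀ n → V (suc (suc n)) ≈ V (suc n) -ₚ xₚ *ₚ V n
V-rec n = begin
  at-x (F (suc n) +ₚ (-ₚ (0ℤ ∷ F n)))     ≈⟨ at-x-+ (F (suc n)) (-ₚ (0ℤ ∷ F n)) ⟩
  V (suc n) +ₚ at-x (-ₚ (0ℤ ∷ F n))       ≈⟨ +ₚ-congˡ (V (suc n)) (at-x-· (ℤ.- 1ℤ) (0ℤ ∷ F n)) ⟩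
  V (suc n) +ₚ const (ℤ.- 1ℤ) *ₚ at-x (0ℤ ∷ F n)
    ≈⟨ +ₚ-congˡ (V (suc n)) (*ₚ-congˡ (const (ℤ.- 1ℤ)) (at-x-shift (F n))) ⟩
  V (suc n) +ₚ const (ℤ.- 1ℤ) *ₚ (xₚ *ₚ V n)
    ≈⟨ +ₚ-congˡ (V (suc n)) (≈-trans (+ₚ-congˡ (-ₚ (xₚ *ₚ V n)) 0∷[]≈[]) (+ₚ-identityʳ _)) ⟩
  V (suc n) -ₚ xₚ *ₚ V n                   ∎
  where open ≈-Reasoning

-- α and β are the roots of t² - t + x, since α + β = 1 and βα = x.
α+β≈1 : αₚ +ₚ βₚ ≈ oneₚ
α+β≈1 = coeffwise λ { 0 → refl ; 1 → refl ; (suc (suc i)) → refl }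

binet : ∀ n → (αₚ -ₚ βₚ) *ₚ V n ≈ αₚ ^ₚ n -ₚ βₚ ^ₚ n
binet zero          = ≈-trans (*ₚ-zeroʳ (αₚ -ₚ βₚ)) (≈-sym (+ₚ-inverseʳ oneₚ))
binet (suc zero)    = begin
  (αₚ -ₚ βₚ) *ₚ (const 1ℤ +ₚ xₚ *ₚ [])    ≈⟨ *ₚ-congˡ (αₚ -ₚ βₚ) (≈-trans (+ₚ-congˡ oneₚ (*ₚ-zeroʳ xₚ)) (+ₚ-identityʳ oneₚ)) ⟩
  (αₚ -ₚ βₚ) *ₚ oneₚ                      ≈⟨ solve 2 (λ a b → (a :- b) :* con 1ℤ := a :* con 1ℤ :- b :* con 1ℤ) ≈-refl αₚ βₚ ⟩
  αₚ ^ₚ 1 -ₚ βₚ ^ₚ 1                     ∎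
  where open ≈-Reasoning
binet (suc (suc n)) = begin
  (αₚ -ₚ βₚ) *ₚ V (suc (suc n))            ≈⟨ *ₚ-congˡ (αₚ -ₚ βₚ) (V-rec n) ⟩
  (αₚ -ₚ βₚ) *ₚ (V (suc n) -ₚ xₚ *ₚ V n)
    ≈⟨ solve 5 (λ a b v₁ x v₀ → (a :- b) :* (v₁ :- x :* v₀) := (a :- b) :* v₁ :- x :* ((a :- b) :* v₀))
               ≈-refl αₚ βₚ (V (suc n)) xₚ (V n) ⟩
  (αₚ -ₚ βₚ) *ₚ V (suc n) -ₚ xₚ *ₚ ((αₚ -ₚ βₚ) *ₚ V n)
    ≈⟨ +ₚ-cong (binet (suc n)) (-ₚ-cong (*ₚ-congˡ xₚ (binet n))) ⟩
  (αₚ *ₚ A -ₚ βₚ *ₚ B) -ₚ (βₚ *ₚ αₚ) *ₚ (A -ₚ B)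
    ≈⟨ +ₚ-congʳ (-ₚ ((βₚ *ₚ αₚ) *ₚ (A -ₚ B))) (≈-trans (≈-sym (*ₚ-identityˡ Y)) (*ₚ-congʳ Y (≈-sym α+β≈1))) ⟩
  (αₚ +ₚ βₚ) *ₚ (αₚ *ₚ A -ₚ βₚ *ₚ B) -ₚ (βₚ *ₚ αₚ) *ₚ (A -ₚ B)
    ≈⟨ solve 4 (λ a b A B → (a :+ b) :* (a :* A :- b :* B) :- (b :* a) :* (A :- B)
                            := a :* (a :* A) :- b :* (b :* B)) ≈-refl αₚ βₚ A B ⟩
  αₚ ^ₚ suc (suc n) -ₚ βₚ ^ₚ suc (suc n)  ∎
  where
  open ≈-Reasoning
  A = αₚ ^ₚ n
  B = βₚ ^ₚ n
  Y = αₚ *ₚ A -ₚ βₚ *ₚ B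

coeff-1+cβ-*ₚ : ∀ c Z i →
  coeff ((1ℤ ∷ c ∷ []) *ₚ Z) (suc i) ≡ coeff Z (suc i) ℤ.+ c ℤ.* coeff Z i
coeff-1+cβ-*ₚ c Z i = begin
  coeff ((1ℤ ∷ c ∷ []) *ₚ Z) (suc i)
    ≡⟨ coeff-+ (1ℤ ·ₚ Z) (0ℤ ∷ (c ·ₚ Z +ₚ (0ℤ ∷ []))) (suc i) ⟩
  coeff (1ℤ ·ₚ Z) (suc i) ℤ.+ coeff (c ·ₚ Z +ₚ (0ℤ ∷ [])) i
    ≡⟨ cong₂ ℤ._+_ (coeff-≡ (1·ₚ Z) (suc i)) (coeff-≡ (+ₚ-congˡ (c ·ₚ Z) 0∷[]≈[]) i) ⟩
  coeff Z (suc i) ℤ.+ coeff (c ·ₚ Z +ₚ []) i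
    ≡⟨ cong (ℤ._+_ (coeff Z (suc i))) (trans (coeff-≡ (+ₚ-identityʳ (c ·ₚ Z)) i) (coeff-· c Z i)) ⟩
  coeff Z (suc i) ℤ.+ c ℤ.* coeff Z i ∎
  where open ≡-Reasoning

-- 1 + cβ is not a zero divisor: the coefficients of Z are determined one by one.
1+cβ-regular : ∀ c Z → (1ℤ ∷ c ∷ []) *ₚ Z ≈ [] → Z ≈ []
1+cβ-regular c Z product≈0 = coeffwise vanish
  where
  vanish : ∀ i → coeff Z i ≡ 0ℤ
  open ≡-Reasoning
  vanish zero    = begin
    coeff Z 0                                    ≡⟨ coeff-≡ (1·ₚ Z) 0 ⟨
    coeff (1ℤ ·ₚ Z) 0                            ≡⟨ ℤP.+-identityʳ _ ⟨
    coeff (1ℤ ·ₚ Z) 0 ℤ.+ 0ℤ                     ≡⟨ coeff-+ (1ℤ ·ₚ Z) (0ℤ ∷ (c ·ₚ Z +ₚ (0ℤ ∷ []))) 0 ⟨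
    coeff ((1ℤ ∷ c ∷ []) *ₚ Z) 0                 ≡⟨ coeff-≡ product≈0 0 ⟩
    0ℤ                                           ∎
  vanish (suc i) = begin
    coeff Z (suc i)                              ≡⟨ ℤP.+-identityʳ _ ⟨
    coeff Z (suc i) ℤ.+ 0ℤ                       ≡⟨ cong (ℤ._+_ (coeff Z (suc i))) (ℤP.*-zeroʳ c) ⟨
    coeff Z (suc i) ℤ.+ c ℤ.* 0ℤ                 ≡⟨ cong (λ z → coeff Z (suc i) ℤ.+ c ℤ.* z) (vanish i) ⟨
    coeff Z (suc i) ℤ.+ c ℤ.* coeff Z i          ≡⟨ coeff-1+cβ-*ₚ c Z i ⟨
    coeff ((1ℤ ∷ c ∷ []) *ₚ Z) (suc i)           ≡⟨ coeff-≡ product≈0 (suc i) ⟩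
    0ℤ                                           ∎

-- Since α - β = 1 - 2β, division by α - β is unique; by Binet's formula
-- the quotient (αⁿ - βⁿ)/(α - β) is therefore Vₙ.
quotient≈V : ∀ n Q → (αₚ -ₚ βₚ) *ₚ Q ≈ αₚ ^ₚ n -ₚ βₚ ^ₚ n → Q ≈ V n
quotient≈V n Q quotient = begin
  Q                  ≈⟨ solve 2 (λ q v → q := (q :- v) :+ v) ≈-refl Q (V n) ⟩
  (Q -ₚ V n) +ₚ V n  ≈⟨ +ₚ-cong (1+cβ-regular (ℤ.- + 2) (Q -ₚ V n) difference≈0) ≈-refl ⟩
  [] +ₚ V n          ∎
  where
  open ≈-Reasoning
  α-β≈1-2β : αₚ -ₚ βₚ ≈ (1ℤ ∷ ℤ.- + 2 ∷ [])
  α-β≈1-2β = coeffwise λ { 0 → refl ; 1 → refl ; (suc (suc i)) → refl }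
  difference≈0 : (1ℤ ∷ ℤ.- + 2 ∷ []) *ₚ (Q -ₚ V n) ≈ []
  difference≈0 = begin
    (1ℤ ∷ ℤ.- + 2 ∷ []) *ₚ (Q -ₚ V n)         ≈⟨ *ₚ-congʳ (Q -ₚ V n) α-β≈1-2β ⟨
    (αₚ -ₚ βₚ) *ₚ (Q -ₚ V n)
      ≈⟨ solve 3 (λ d q v → d :* (q :- v) := d :* q :- d :* v) ≈-refl (αₚ -ₚ βₚ) Q (V n) ⟩
    (αₚ -ₚ βₚ) *ₚ Q -ₚ (αₚ -ₚ βₚ) *ₚ V n      ≈⟨ +ₚ-cong quotient (-ₚ-cong (binet n)) ⟩
    (αₚ ^ₚ n -ₚ βₚ ^ₚ n) -ₚ (αₚ ^ₚ n -ₚ βₚ ^ₚ n)  ≈⟨ +ₚ-inverseʳ (αₚ ^ₚ n -ₚ βₚ ^ₚ n) ⟩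
    []                                        ∎

-- The coefficients of Fₙ₊₁ are signed diagonal binomial coefficients:
-- Fₙ₊₁ = Σₖ (-1)ᵏ C(n - k, k) yᵏ.

sign : ℕ → ℤ
sign zero    = 1ℤ
sign (suc k) = ℤ.- sign k

-- Pascal's rule along the diagonal n - k, valid also when j > m (all terms vanish then).
pascal-diagonal : ∀ m j → (suc m ∸ j) C suc j ≡ (m ∸ j) C suc j ℕ.+ (m ∸ j) C j
pascal-diagonal m j with j ℕP.≤? m
... | yes j≤m rewrite ℕP.+-∸-assoc 1 j≤m =
  trans (sym (nCk+nC[k+1]≡[n+1]C[k+1] (m ∸ j) j)) (ℕP.+-comm ((m ∸ j) C j) _)
... | no j≰m = begin
  (suc m ∸ j) C suc j                   ≡⟨ k>n⇒nCk≡0 (ℕ.s≤s (ℕP.≤-trans (ℕP.m∸n≤m (suc m) j) m<j)) ⟩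
  0                                     ≡⟨ cong₂ ℕ._+_ (k>n⇒nCk≡0 (ℕ.s≤s m∸j≤j)) (k>n⇒nCk≡0 m∸j<j) ⟨
  (m ∸ j) C suc j ℕ.+ (m ∸ j) C j       ∎
  where
  open ≡-Reasoning
  m<j : m ℕ.< j
  m<j = ℕP.≰⇒> j≰m
  m∸j<j : m ∸ j ℕ.< j
  m∸j<j = ℕP.≤-<-trans (ℕP.m∸n≤m m j) m<j
  m∸j≤j : m ∸ j ℕ.≤ j
  m∸j≤j = ℕP.<⇒≤ m∸j<j

DiagonalCoefficients : ℕ → Set
DiagonalCoefficients n = ∀ k → coeff (F (suc n)) k ≡ sign k ℤ.* + ((n ∸ k) C k)

-- The recurrence Fₘ₊₃ = Fₘ₊₂ - y Fₘ₊₁ combined with Pascal's rule.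
coeff-F-step : ∀ m → DiagonalCoefficients (suc m) → DiagonalCoefficients m →
               DiagonalCoefficients (suc (suc m))
coeff-F-step m coeff-F₂ coeff-F₁ k = begin
  coeff (F (suc (suc (suc m)))) k
    ≡⟨ coeff-+ (F (suc (suc m))) (-ₚ (0ℤ ∷ F (suc m))) k ⟩
  coeff (F (suc (suc m))) k ℤ.+ coeff (-ₚ (0ℤ ∷ F (suc m))) k
    ≡⟨ cong (ℤ._+_ (coeff (F (suc (suc m))) k)) (coeff-· (ℤ.- 1ℤ) (0ℤ ∷ F (suc m)) k) ⟩
  coeff (F (suc (suc m))) k ℤ.+ ℤ.- 1ℤ ℤ.* coeff (0ℤ ∷ F (suc m)) k
    ≡⟨ recurrence k ⟩
  sign k ℤ.* + ((suc (suc m) ∸ k) C k) ∎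
  where
  open ≡-Reasoning
  recurrence : ∀ k → coeff (F (suc (suc m))) k ℤ.+ ℤ.- 1ℤ ℤ.* coeff (0ℤ ∷ F (suc m)) k
                     ≡ sign k ℤ.* + ((suc (suc m) ∸ k) C k)
  recurrence zero rewrite coeff-F₂ zero = refl
  recurrence (suc j) rewrite coeff-F₂ (suc j) | coeff-F₁ j | pascal-diagonal m j
                           | ℤP.pos-+ ((m ∸ j) C suc j) ((m ∸ j) C j) =
    ZS.solve 3 (λ s X Y → (ZS.:- s) ZS.:* X ZS.:+ (ZS.:- ZS.con 1ℤ) ZS.:* (s ZS.:* Y)
                          ZS.:= (ZS.:- s) ZS.:* (X ZS.:+ Y))
               refl (sign j) (+ ((m ∸ j) C suc j)) (+ ((m ∸ j) C j))

coeff-F : ∀ n → DiagonalCoefficients n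
coeff-F zero          zero          = refl
coeff-F zero          (suc k)       = sym (ℤP.*-zeroʳ (sign (suc k)))
coeff-F (suc zero)    zero          = refl
coeff-F (suc zero)    (suc zero)    = refl
coeff-F (suc zero)    (suc (suc k)) = sym (ℤP.*-zeroʳ (sign (suc (suc k))))
coeff-F (suc (suc m))               = coeff-F-step m (coeff-F (suc m)) (coeff-F m)

coeff-F-vanishes : ∀ n k → n ℕ.< k ℕ.+ k → coeff (F (suc n)) k ≡ 0ℤ
coeff-F-vanishes n zero    ()
coeff-F-vanishes n (suc k) n<2k = begin
  coeff (F (suc n)) (suc k)                     ≡⟨ coeff-F n (suc k) ⟩
  sign (suc k) ℤ.* + ((n ∸ suc k) C suc k)      ≡⟨ cong (λ c → sign (suc k) ℤ.* + c)
                                                        (k>n⇒nCk≡0 (ℕP.m<n+o⇒m∸n<o n (suc k) n<2k)) ⟩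
  sign (suc k) ℤ.* 0ℤ                           ≡⟨ ℤP.*-zeroʳ (sign (suc k)) ⟩
  0ℤ                                            ∎
  where open ≡-Reasoning

module Congruence (p : ℕ) where

  infix 4 _≋_ _∼_

  -- a ≡ b (mod p), i.e. p ∣ a - b; a record, so that a and b can be inferred.
  record _≋_ (a b : ℤ) : Set where
    constructor ≋-intro
    field p∣a-b : + p ∣ a ℤ.- b
  open _≋_

  ≋-reflexive : ∀ {a b} → a ≡ b → a ≋ b
  ≋-reflexive {a} refl = ≋-intro (subst (+ p ∣_) (sym (ℤP.+-inverseʳ a)) (divides 0ℤ refl))

  ≋-sym : ∀ {a b} → a ≋ b → b ≋ a
  ≋-sym {a} {b} (≋-intro p∣a-b) = ≋-intro
    (subst (+ p ∣_) (ZS.solve 2 (λ a b → ZS.:- (a ZS.:- b) ZS.:= b ZS.:- a) refl a b) (∣m⇒∣-m p∣a-b))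

  ≋-trans : ∀ {a b c} → a ≋ b → b ≋ c → a ≋ c
  ≋-trans {a} {b} {c} (≋-intro p∣a-b) (≋-intro p∣b-c) = ≋-intro $
    subst (+ p ∣_) (ZS.solve 3 (λ a b c → (a ZS.:- b) ZS.:+ (b ZS.:- c) ZS.:= a ZS.:- c) refl a b c)
          (∣m∣n⇒∣m+n p∣a-b p∣b-c)

  ≋-+ : ∀ {a a′ b b′} → a ≋ a′ → b ≋ b′ → a ℤ.+ b ≋ a′ ℤ.+ b′
  ≋-+ {a} {a′} {b} {b′} (≋-intro p∣a-a′) (≋-intro p∣b-b′) = ≋-intro $
    subst (+ p ∣_) (ZS.solve 4 (λ a a′ b b′ → (a ZS.:- a′) ZS.:+ (b ZS.:- b′)
                                               ZS.:= (a ZS.:+ b) ZS.:- (a′ ZS.:+ b′)) refl a a′ b b′)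
          (∣m∣n⇒∣m+n p∣a-a′ p∣b-b′)

  ≋-*ʳ : ∀ {a b} c → a ≋ b → a ℤ.* c ≋ b ℤ.* c
  ≋-*ʳ {a} {b} c (≋-intro p∣a-b) = ≋-intro $
    subst (+ p ∣_) (ZS.solve 3 (λ a b c → (a ZS.:- b) ZS.:* c ZS.:= a ZS.:* c ZS.:- b ZS.:* c) refl a b c)
          (∣m⇒∣m*n c p∣a-b)

  multiple≋0 : ∀ {a} → + p ∣ a → a ≋ 0ℤ
  multiple≋0 {a} p∣a = ≋-intro $ subst (+ p ∣_) (sym (ℤP.+-identityʳ a)) p∣a

  record _∼_ (P Q : Poly) : Set where
    constructor coeffwise-≋
    field coeff-≋ : ∀ i → coeff P i ≋ coeff Q i
  open _∼_

  ≈⇒∼ : ∀ {P Q} → P ≈ Q → P ∼ Q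
  ≈⇒∼ P≈Q = coeffwise-≋ λ i → ≋-reflexive (coeff-≡ P≈Q i)

  ∼-trans : ∀ {P Q R} → P ∼ Q → Q ∼ R → P ∼ R
  ∼-trans P∼Q Q∼R = coeffwise-≋ λ i → ≋-trans (coeff-≋ P∼Q i) (coeff-≋ Q∼R i)

  ∼-+ : ∀ {P P′ Q Q′} → P ∼ P′ → Q ∼ Q′ → P +ₚ Q ∼ P′ +ₚ Q′
  ∼-+ {P} {P′} {Q} {Q′} P∼P′ Q∼Q′ = coeffwise-≋ λ i →
    subst₂ _≋_ (sym (coeff-+ P Q i)) (sym (coeff-+ P′ Q′ i)) (≋-+ (coeff-≋ P∼P′ i) (coeff-≋ Q∼Q′ i))

  ·ₚ-∼ : ∀ {a b} X → a ≋ b → a ·ₚ X ∼ b ·ₚ X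
  ·ₚ-∼ {a} {b} X a≋b = coeffwise-≋ λ i →
    subst₂ _≋_ (sym (coeff-· a X i)) (sym (coeff-· b X i)) (≋-*ʳ (coeff X i) a≋b)

  Σₚ-∼ : ∀ N {f g} → (∀ k → k ℕ.< N → f k ∼ g k) → Σₚ N f ∼ Σₚ N g
  Σₚ-∼ zero    f∼g = ≈⇒∼ ≈-refl
  Σₚ-∼ (suc N) f∼g = ∼-+ (Σₚ-∼ N λ k k<N → f∼g k (ℕP.m<n⇒m<1+n k<N)) (f∼g N (ℕP.n<1+n N))

  ∼⇒≡ₚ : ∀ {P Q} → P ∼ Q → P ≡ₚ Q [mod p ]
  ∼⇒≡ₚ P∼Q i = ∣⇒∣ᵤ (p∣a-b (coeff-≋ P∼Q i))

  sum∼quotient : ∀ n K f Q → (αₚ -ₚ βₚ) *ₚ Q ≈ αₚ ^ₚ n -ₚ βₚ ^ₚ n →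
                 (∀ k → K ℕ.≤ k → coeff (F n) k ≡ 0ℤ) →
                 (∀ k → k ℕ.< K → f k ∼ coeff (F n) k ·ₚ (xₚ ^ₚ k)) →
                 Σₚ K f ∼ Q
  sum∼quotient n K f Q quotient F-degree<K f∼coeff-F =
    ∼-trans (Σₚ-∼ K f∼coeff-F)
            (≈⇒∼ (≈-trans (≈-sym (at-x-as-sum (F n) K F-degree<K)) (≈-sym (quotient≈V n Q quotient))))

binomial-absorption : ∀ n k → suc k ℕ.* (suc n C suc k) ≡ suc n ℕ.* (n C k)
binomial-absorption zero    zero    = refl
binomial-absorption zero    (suc k)
  rewrite k>n⇒nCk≡0 {1} {suc (suc k)} (ℕ.s≤s (ℕ.s≤s ℕ.z≤n)) | k>n⇒nCk≡0 {0} {suc k} (ℕ.s≤s ℕ.z≤n) =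
  ℕP.*-zeroʳ (suc (suc k))
binomial-absorption (suc n) zero    =
  trans (ℕP.+-identityʳ _) (trans (nC1≡n (suc (suc n))) (sym (ℕP.*-identityʳ (suc (suc n)))))
binomial-absorption (suc n) (suc k) = begin
  suc (suc k) ℕ.* (suc (suc n) C suc (suc k))
    ≡⟨ cong (suc (suc k) ℕ.*_) (nCk+nC[k+1]≡[n+1]C[k+1] (suc n) (suc k)) ⟨
  suc (suc k) ℕ.* (A ℕ.+ B)
    ≡⟨ NS.solve 3 (λ k A B → (NS.con 2 :+ k) :* (A :+ B) := A :+ ((NS.con 1 :+ k) :* A :+ (NS.con 2 :+ k) :* B))
                  refl k A B ⟩
  A ℕ.+ (suc k ℕ.* A ℕ.+ suc (suc k) ℕ.* B)
    ≡⟨ cong (A ℕ.+_) (cong₂ ℕ._+_ (binomial-absorption n k) (binomial-absorption n (suc k))) ⟩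
  A ℕ.+ (suc n ℕ.* (n C k) ℕ.+ suc n ℕ.* (n C suc k))
    ≡⟨ cong (A ℕ.+_) (ℕP.*-distribˡ-+ (suc n) (n C k) (n C suc k)) ⟨
  A ℕ.+ suc n ℕ.* (n C k ℕ.+ n C suc k)
    ≡⟨ cong (λ c → A ℕ.+ suc n ℕ.* c) (nCk+nC[k+1]≡[n+1]C[k+1] n k) ⟩
  suc (suc n) ℕ.* A ∎
  where
  open ≡-Reasoning
  open NS using (_:+_; _:*_; _:=_)
  A = suc n C suc k
  B = suc n C suc (suc k)

module _ {p : ℕ} (p-prime : Prime p) where

  instance
    p≢0 : ℕ.NonZero p
    p≢0 = prime⇒nonZero p-prime

  -- If pᵃ divides jX but not j, then p divides X (peel off one factor p of j at a time).
  prime-power-cofactor : ∀ a j X → p ℕ.^ a ∣ℕ j ℕ.* X → ¬ (p ℕ.^ a ∣ℕ j) → p ∣ℕ X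
  prime-power-cofactor zero    j X _   pᵃ∤j = ⊥-elim (pᵃ∤j (ℕ∣.1∣ j))
  prime-power-cofactor (suc a) j X pᵃ∣jX pᵃ∤j
    with euclidsLemma j X p-prime (ℕ∣.∣-trans (ℕ∣.m∣m*n (p ℕ.^ a)) pᵃ∣jX)
  ... | inj₂ p∣X = p∣X
  ... | inj₁ (divides-refl c) = prime-power-cofactor a c X pᵃ∣cX pᵃ∤c
    where
    pᵃ∣cX : p ℕ.^ a ∣ℕ c ℕ.* X
    pᵃ∣cX = ℕ∣.*-cancelˡ-∣ p (subst (p ℕ.* p ℕ.^ a ∣ℕ_) (NS.solve 3 (λ c p X → (c :* p) :* X := p :* (c :* X)) refl c p X) pᵃ∣jX)
      where open NS using (_:*_; _:=_)
    pᵃ∤c : ¬ (p ℕ.^ a ∣ℕ c)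
    pᵃ∤c pᵃ∣c = pᵃ∤j (subst (p ℕ.* p ℕ.^ a ∣ℕ_) (ℕP.*-comm p c) (ℕ∣.*-monoʳ-∣ p pᵃ∣c))

  -- If pᵐ ∣ N and 0 < j < pᵐ then p ∣ C(N, j): from j C(N, j) = N C(N - 1, j - 1),
  -- since pᵐ divides the right-hand side but not j.
  p∣binomial : ∀ m N j → p ℕ.^ m ∣ℕ N → 0 ℕ.< j → j ℕ.< p ℕ.^ m → p ∣ℕ N C j
  p∣binomial m zero    (suc j) _   _ _    = ℕ∣.divides 0 refl
  p∣binomial m (suc N) (suc j) q∣N _ j<q =
    prime-power-cofactor m (suc j) (suc N C suc j)
      (subst (p ℕ.^ m ∣ℕ_) (sym (binomial-absorption N j)) (ℕ∣.∣m⇒∣m*n (N C j) q∣N))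
      (λ q∣j → ℕP.<⇒≱ j<q (ℕ∣.∣⇒≤ q∣j))

module _ {p : ℕ} (p-prime : Prime p) (m N : ℕ) (q∣N : p ℕ.^ m ∣ℕ N) where
  open Congruence p

  -- Modulo p, C(N - s, j) ≡ (-1)ʲ C(s + j - 1, j) = C(-s, j) for s ≤ N and j < pᵐ:
  -- both sides satisfy Pascal's recurrence in (s, j), and they agree on the boundary
  -- j = 0 trivially and on s = 0 because p ∣ C(N, j) for 0 < j < pᵐ.
  negative-binomial : ∀ s j → s ℕ.≤ N → j ℕ.< p ℕ.^ m →
                      sign j ℤ.* + ((N ∸ s) C j) ≋ + ((s ℕ.+ j ∸ 1) C j)
  negative-binomial s       zero    _   _   = ≋-reflexive refl
  negative-binomial zero    (suc j) _   j<q rewrite k>n⇒nCk≡0 (ℕP.n<1+n j) =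
    multiple≋0 (∣n⇒∣m*n (sign (suc j)) (∣ᵤ⇒∣ (p∣binomial p-prime m N (suc j) q∣N ℕ.z<s j<q)))
  negative-binomial (suc s) (suc j) s<N j<q =
    subst₂ _≋_ (sym left-pascal) (sym right-pascal)
      (≋-+ (negative-binomial s (suc j) (ℕP.<⇒≤ s<N) j<q)
           (negative-binomial (suc s) j s<N (ℕP.<-trans (ℕP.n<1+n j) j<q)))
    where
    open ≡-Reasoning
    left-pascal : sign (suc j) ℤ.* + ((N ∸ suc s) C suc j)
                  ≡ sign (suc j) ℤ.* + ((N ∸ s) C suc j) ℤ.+ sign j ℤ.* + ((N ∸ suc s) C j)
    left-pascal rewrite ℕP.+-∸-assoc 1 s<N
                      | sym (nCk+nC[k+1]≡[n+1]C[k+1] (N ∸ suc s) j)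
                      | ℤP.pos-+ ((N ∸ suc s) C j) ((N ∸ suc s) C suc j) =
      ZS.solve 3 (λ σ A B → (ZS.:- σ) ZS.:* B ZS.:= (ZS.:- σ) ZS.:* (A ZS.:+ B) ZS.:+ σ ZS.:* A)
                 refl (sign j) (+ ((N ∸ suc s) C j)) (+ ((N ∸ suc s) C suc j))
    right-pascal : + ((s ℕ.+ suc j) C suc j) ≡ + ((s ℕ.+ suc j ∸ 1) C suc j) ℤ.+ + ((s ℕ.+ j) C j)
    right-pascal rewrite ℕP.+-suc s j = begin
      + ((suc (s ℕ.+ j)) C suc j)                        ≡⟨ cong +_ (nCk+nC[k+1]≡[n+1]C[k+1] (s ℕ.+ j) j) ⟨
      + ((s ℕ.+ j) C j ℕ.+ (s ℕ.+ j) C suc j)            ≡⟨ ℤP.pos-+ ((s ℕ.+ j) C j) ((s ℕ.+ j) C suc j) ⟩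
      + ((s ℕ.+ j) C j) ℤ.+ + ((s ℕ.+ j) C suc j)        ≡⟨ ℤP.+-comm (+ ((s ℕ.+ j) C j)) (+ ((s ℕ.+ j) C suc j)) ⟩
      + ((s ℕ.+ j) C suc j) ℤ.+ + ((s ℕ.+ j) C j)        ∎

  -- The summands of the theorem: C(2k + e, k) ≡ [yᵏ] F_{N-e} (mod p) for e + k < N, k < pᵐ
  -- (take s = e + k + 1 above and use the coefficient formula for F).
  binomial≋coeff-F : ∀ e k → e ℕ.+ k ℕ.< N → k ℕ.< p ℕ.^ m →
                     + ((2 ℕ.* k ℕ.+ e) C k) ≋ coeff (F (suc (N ∸ suc e))) k
  binomial≋coeff-F e k e+k<N k<q =
    ≋-sym (subst₂ _≋_ (sym coefficient) (cong (λ n → + (n C k)) 2k+e≡e+k+k)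
                      (negative-binomial (suc (e ℕ.+ k)) k e+k<N k<q))
    where
    coefficient : coeff (F (suc (N ∸ suc e))) k ≡ sign k ℤ.* + ((N ∸ suc (e ℕ.+ k)) C k)
    coefficient = trans (coeff-F (N ∸ suc e) k) (cong (λ n → sign k ℤ.* + (n C k)) (ℕP.∸-+-assoc N (suc e) k))
    2k+e≡e+k+k : e ℕ.+ k ℕ.+ k ≡ 2 ℕ.* k ℕ.+ e
    2k+e≡e+k+k = NS.solve 2 (λ e k → e :+ k :+ k := NS.con 2 :* k :+ e) refl e k
      where open NS using (_:+_; _:*_; _:=_)

∸-as-suc : ∀ {N e} → e ℕ.< N → N ∸ e ≡ suc (N ∸ suc e)
∸-as-suc = ℕP.+-∸-assoc 1

module _ {p : ℕ} (p-prime : Prime p) (m e : ℕ) (e<q : e ℕ.< p ℕ.^ m) where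
  open Congruence p

  Quotient : ℕ → Poly → Set
  Quotient n Q = (αₚ -ₚ βₚ) *ₚ Q ≈ αₚ ^ₚ n -ₚ βₚ ^ₚ n

  -- Σ_{2k < q-e} C(2k+e, k) xᵏ ≡ (α^{q-e} - β^{q-e})/(α - β). The summands with
  -- 2k ≥ q - e are exactly those where F_{q-e} has zero coefficient.
  first-congruence : ∀ Q → Quotient (p ℕ.^ m ∸ e) Q → lhs₁ (p ℕ.^ m) e ∼ Q
  first-congruence Q quotient =
    sum∼quotient (suc n) q _ Q (subst (λ n → Quotient n Q) (∸-as-suc e<q) quotient)
      (λ k q≤k → coeff-F-vanishes n k (ℕP.<-≤-trans n<q (ℕP.≤-trans q≤k (ℕP.m≤m+n k k))))
      congruent-terms
    where
    q = p ℕ.^ m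
    n = q ∸ suc e
    n<q : n ℕ.< q
    n<q = ℕP.≤-trans (ℕP.≤-reflexive (sym (∸-as-suc e<q))) (ℕP.m∸n≤m q e)
    congruent-terms : ∀ k → k ℕ.< q →
      (if ⌊ 2 ℕ.* k <? q ∸ e ⌋ then term e k else []) ∼ coeff (F (suc n)) k ·ₚ (xₚ ^ₚ k)
    congruent-terms k k<q with 2 ℕ.* k <? q ∸ e
    ... | yes 2k<q-e = ·ₚ-∼ (xₚ ^ₚ k) (binomial≋coeff-F p-prime m q ℕ∣.∣-refl e k e+k<q k<q)
      where
      e+k<q : e ℕ.+ k ℕ.< q
      e+k<q = subst (e ℕ.+ k ℕ.<_) (ℕP.m+[n∸m]≡n (ℕP.<⇒≤ e<q))
                (ℕP.+-monoʳ-< e (ℕP.≤-<-trans (ℕP.m≤m+n k (k ℕ.+ 0)) 2k<q-e))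
    ... | no 2k≮q-e = ≈⇒∼ (≈-sym (zero·ₚ (xₚ ^ₚ k) (coeff-F-vanishes n k n<2k)))
      where
      n<2k : n ℕ.< k ℕ.+ k
      n<2k = subst₂ ℕ._≤_ (∸-as-suc e<q) (cong (k ℕ.+_) (ℕP.+-identityʳ k)) (ℕP.≮⇒≥ 2k≮q-e)

  -- Σ_{k < q} C(2k+e, k) xᵏ ≡ (α^{2q-e} - β^{2q-e})/(α - β); here F_{2q-e} has
  -- degree < q, and every summand is congruent to the matching term of F_{2q-e}(x).
  second-congruence : ∀ Q → Quotient (2 ℕ.* p ℕ.^ m ∸ e) Q → lhs₂ (p ℕ.^ m) e ∼ Q
  second-congruence Q quotient =
    sum∼quotient (suc n) q (term e) Q (subst (λ n → Quotient n Q) (∸-as-suc e<2q) quotient)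
      (λ k q≤k → coeff-F-vanishes n k (ℕP.<-≤-trans n<2q (ℕP.+-mono-≤ q≤k (ℕP.≤-trans (ℕP.≤-reflexive (ℕP.+-identityʳ q)) q≤k))))
      (λ k k<q → ·ₚ-∼ (xₚ ^ₚ k)
                   (binomial≋coeff-F p-prime m (2 ℕ.* q) (ℕ∣.∣n⇒∣m*n 2 ℕ∣.∣-refl) e k
                     (subst (e ℕ.+ k ℕ.<_) 2q≡q+q (ℕP.+-mono-< e<q k<q)) k<q))
    where
    q = p ℕ.^ m
    n = 2 ℕ.* q ∸ suc e
    2q≡q+q : q ℕ.+ q ≡ 2 ℕ.* q
    2q≡q+q = cong (q ℕ.+_) (sym (ℕP.+-identityʳ q))
    e<2q : e ℕ.< 2 ℕ.* q
    e<2q = ℕP.<-≤-trans e<q (ℕP.m≤m+n q (q ℕ.+ 0))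
    n<2q : n ℕ.< 2 ℕ.* q
    n<2q = ℕP.≤-trans (ℕP.≤-reflexive (sym (∸-as-suc e<2q))) (ℕP.m∸n≤m (2 ℕ.* q) e)

-- Theorem 3.1.
theorem3p1 : (p m e : ℕ) → Prime p → p % 2 ≡ 1 → 1 ≤ m → e < p ^ m →
    ((Q : Poly) → (αₚ -ₚ βₚ) *ₚ Q ≈ₚ ((αₚ ^ₚ (p ^ m ∸ e)) -ₚ (βₚ ^ₚ (p ^ m ∸ e))) →
      lhs₁ (p ^ m) e ≡ₚ Q [mod p ])
    × ((Q : Poly) → (αₚ -ₚ βₚ) *ₚ Q ≈ₚ ((αₚ ^ₚ (2 * p ^ m ∸ e)) -ₚ (βₚ ^ₚ (2 * p ^ m ∸ e))) →
      lhs₂ (p ^ m) e ≡ₚ Q [mod p ])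
theorem3p1 p m e p-prime _ _ e<q =
    (λ Q quotient → ∼⇒≡ₚ (first-congruence p-prime m e e<q Q (coeffwise quotient)))
  , (λ Q quotient → ∼⇒≡ₚ (second-congruence p-prime m e e<q Q (coeffwise quotient)))
  where open Congruence p
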